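{- Let $G$ be a graph of order $n\ge 2$ with minimum degree $\delta(G)=1$, let $x$ be a vertex of degree $1$ and let $y$ be the neighbor of $x$. Then $PC(G)=n$ if and only if $y$ is adjacent to all other vertices of $G$ (i.e., $y$ has degree $n-1$).
   Context: A paired dominating set of $G$ is a dominating set $S$ such that $G[S]$ has a perfect matching. Two disjoint sets form a paired coalition if neither is a paired dominating set but their union is. A $pc$-partition of $G$ is a partition of $V(G)$ into nonempty sets, none a paired dominating set, each forming a paired coalition with some other set of the partition. $PC(G)$ is the maximum number of sets in a $pc$-partition ($0$ if none exists). -}

module Defs where

open import Data.Nat using (ℕ; _≤_; _∸_)
open import Data.Fin using (Fin)
open import Data.Fin.Subset using (∣_∣)
open import Data.Vec using (tabulate)
open import Data.Bool using (Bool; T)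
open import Data.Product using (Σ; ∃; _×_)
open import Data.Sum using (_⊎_)
open import Data.Empty using (⊥)
open import Relation.Nullary using (¬_)
open import Relation.Binary.PropositionalEquality using (_≡_; _≢_)

record Graph (n : ℕ) : Set where
  field
    adj   : Fin n → Fin n → Bool
    sym   : ∀ u v → adj u v ≡ adj v u
    irrfl : ∀ v → adj v v ≡ Data.Bool.false

open Graph public

Adj : ∀ {n} → Graph n → Fin n → Fin n → Set
Adj G u v = T (adj G u v)

deg : ∀ {n} → Graph n → Fin n → ℕ
deg G v = ∣ tabulate (adj G v) ∣

VSet : ℕ → Set₁
VSet n = Fin n → Set

Dominating : ∀ {n} → Graph n → VSet n → Set
Dominating {n} G S = ∀ v → S v ⊎ Σ (Fin n) (λ u → S u × Adj G v u)

-- G[S] has a perfect matching: a partner map μ on S with μ v ∈ S,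
-- v adjacent to μ v (hence μ v ≠ v), and μ (μ v) = v.
HasPerfectMatching : ∀ {n} → Graph n → VSet n → Set
HasPerfectMatching {n} G S =
  Σ (Fin n → Fin n) λ μ → ∀ v → S v → S (μ v) × Adj G v (μ v) × μ (μ v) ≡ v

PairedDominating : ∀ {n} → Graph n → VSet n → Set
PairedDominating G S = Dominating G S × HasPerfectMatching G S

_∪_ : ∀ {n} → VSet n → VSet n → VSet n
(A ∪ B) v = A v ⊎ B v

PairedCoalition : ∀ {n} → Graph n → VSet n → VSet n → Set
PairedCoalition {n} G A B =
  (∀ v → A v → B v → ⊥) × ¬ PairedDominating G A × ¬ PairedDominating G B
  × PairedDominating G (A ∪ B)

-- A partition of V(G) into k nonempty sets, encoded by a class map
-- f : Fin n → Fin k (class i = f⁻¹(i)); surjectivity = nonempty classes.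
Class : ∀ {n k} → (Fin n → Fin k) → Fin k → VSet n
Class f i v = f v ≡ i

PCPartition : ∀ {n} → Graph n → ℕ → Set
PCPartition {n} G k =
  Σ (Fin n → Fin k) λ f →
    (∀ i → ∃ λ v → f v ≡ i)
    × (∀ i → ¬ PairedDominating G (Class f i))
    × (∀ i → Σ (Fin k) λ j → j ≢ i × PairedCoalition G (Class f i) (Class f j))

-- PC(G) = m : m is the maximum number of sets in a pc-partition,
-- or m = 0 if no pc-partition exists.
PCNumberIs : ∀ {n} → Graph n → ℕ → Set
PCNumberIs G m =
  (PCPartition G m × (∀ k → PCPartition G k → k ≤ m))
  ⊎ (m ≡ 0 × (∀ k → ¬ PCPartition G k))

MinDegreeIs : ∀ {n} → Graph n → ℕ → Set
MinDegreeIs {n} G d = (∀ v → d ≤ deg G v) × Σ (Fin n) (λ v → deg G v ≡ d)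

{-# OPTIONS --safe #-}
-- A pc-partition into n nonempty sets is the partition into singletons.  In
-- the coalition containing {x}, the pendant vertex x can only be matched to
-- y, so that coalition is {x} ∪ {y}, and {x, y} dominates G exactly when y is
-- adjacent to every other vertex.  Conversely, if y is universal, then
-- {v} ∪ {y} is paired dominating for every v ≠ y (matched along the edge vy),
-- and {y} forms a paired coalition with {x}.
module Submission where

open import Defs hiding (sym)
open import Data.Nat using (ℕ; _≤_; suc)
open import Data.Nat.Properties using (<-irrefl; 1+n≰n)
open import Data.Fin using (Fin; _≟_; punchIn; punchOut)
open import Data.Fin.Properties using (injective⇒≤; punchIn-punchOut)
open import Data.Fin.Subset using (Subset; ∣_∣; ⁅_⁆; _∈_; _⊂_)
open import Data.Fin.Subset.Properties using (∣⁅x⁆∣≡1; x∈⁅y⁆⇒x≡y; x≢y⇒x∉⁅y⁆; p⊂q⇒∣p∣<∣q∣)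
open import Data.Vec using (tabulate)
open import Data.Vec.Properties using (lookup∘tabulate; lookup⇒[]=)
open import Data.Bool using (T)
open import Data.Bool.Properties using (T-≡)
open import Data.Product using (Σ; _×_; _,_; proj₁; proj₂)
open import Data.Sum using (_⊎_; inj₁; inj₂)
open import Function using (_∘_)
open import Function.Bundles using (_⇔_; mk⇔; Equivalence)
open import Function.Definitions using (Injective; StrictlySurjective)
open import Relation.Nullary using (¬_; yes; no; contradiction)
open import Relation.Binary.PropositionalEquality using (_≡_; _≢_; refl; sym; trans; cong; subst)

∣p∣≡1⇒∈-unique : ∀ {n} {p : Subset n} {i j : Fin n} → ∣ p ∣ ≡ 1 → i ∈ p → j ∈ p → i ≡ j
∣p∣≡1⇒∈-unique {p = p} {i} {j} ∣p∣≡1 i∈p j∈p with i ≟ j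
... | yes i≡j = i≡j
... | no i≢j = contradiction (p⊂q⇒∣p∣<∣q∣ ⁅i⁆⊂p) (<-irrefl (trans (∣⁅x⁆∣≡1 i) (sym ∣p∣≡1)))
  where
  ⁅i⁆⊂p : ⁅ i ⁆ ⊂ p
  ⁅i⁆⊂p = (λ {v} v∈⁅i⁆ → subst (_∈ p) (sym (x∈⁅y⁆⇒x≡y i v∈⁅i⁆)) i∈p)
        , j , j∈p , x≢y⇒x∉⁅y⁆ (i≢j ∘ sym)

strictlySurjective⇒≤ : ∀ {m k} {f : Fin m → Fin k} → StrictlySurjective _≡_ f → k ≤ m
strictlySurjective⇒≤ {f = f} surj = injective⇒≤ section-injective
  where
  section-injective : Injective _≡_ _≡_ (proj₁ ∘ surj)
  section-injective {i} {j} eq = trans (sym (proj₂ (surj i))) (trans (cong f eq) (proj₂ (surj j)))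

-- If f a ≡ f b with a ≢ b, then f stays surjective after deleting b from its domain.
strictlySurjective⇒injective : ∀ {n} {f : Fin n → Fin n} → StrictlySurjective _≡_ f → Injective _≡_ _≡_ f
strictlySurjective⇒injective {suc m} {f} surj {a} {b} fa≡fb with a ≟ b
... | yes a≡b = a≡b
... | no a≢b = contradiction (strictlySurjective⇒≤ surj-without-b) 1+n≰n
  where
  surj-without-b : StrictlySurjective _≡_ (f ∘ punchIn b)
  surj-without-b i with surj i
  ... | v , fv≡i with v ≟ b
  ...   | yes refl = punchOut (a≢b ∘ sym) , trans (cong f (punchIn-punchOut (a≢b ∘ sym))) (trans fa≡fb fv≡i)
  ...   | no v≢b = punchOut (v≢b ∘ sym) , trans (cong f (punchIn-punchOut (v≢b ∘ sym))) fv≡i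

module _ {n : ℕ} (G : Graph n) where

  Universal : Fin n → Set
  Universal y = ∀ z → z ≢ y → Adj G y z

  Adj-sym : ∀ {u v} → Adj G u v → Adj G v u
  Adj-sym {u} {v} = subst T (Graph.sym G u v)

  Adj⇒≢ : ∀ {u v} → Adj G u v → u ≢ v
  Adj⇒≢ {u} a refl = subst T (irrfl G u) a

  Adj⇒∈neighbours : ∀ {u v} → Adj G u v → v ∈ tabulate (adj G u)
  Adj⇒∈neighbours {u} {v} a = lookup⇒[]= v _ (trans (lookup∘tabulate (adj G u) v) (Equivalence.to T-≡ a))

  deg≡1⇒Adj-unique : ∀ {x u v} → deg G x ≡ 1 → Adj G x u → Adj G x v → u ≡ v
  deg≡1⇒Adj-unique dx xu xv = ∣p∣≡1⇒∈-unique dx (Adj⇒∈neighbours xu) (Adj⇒∈neighbours xv)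

  Dominating-mono : ∀ {A B : VSet n} → (∀ {v} → A v → B v) → Dominating G A → Dominating G B
  Dominating-mono A⊆B dom v with dom v
  ... | inj₁ v∈A = inj₁ (A⊆B v∈A)
  ... | inj₂ (u , u∈A , vu) = inj₂ (u , A⊆B u∈A , vu)

  Universal⇒Dominating : ∀ {y} → Universal y → Dominating G (_≡ y)
  Universal⇒Dominating {y} U v with v ≟ y
  ... | yes v≡y = inj₁ v≡y
  ... | no v≢y = inj₂ (y , refl , Adj-sym (U v v≢y))

  ¬HasPerfectMatching-singleton : ∀ {v} → ¬ HasPerfectMatching G (_≡ v)
  ¬HasPerfectMatching-singleton {v} (μ , matched) with matched v refl
  ... | μv≡v , vμv , _ = Adj⇒≢ vμv (sym μv≡v)

  HasPerfectMatching-edge : ∀ {u w} → Adj G u w → HasPerfectMatching G ((_≡ u) ∪ (_≡ w))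
  HasPerfectMatching-edge {u} {w} uw = μ , matched
    where
    μ : Fin n → Fin n
    μ v with v ≟ u
    ... | yes _ = w
    ... | no _ = u

    μu≡w : μ u ≡ w
    μu≡w with u ≟ u
    ... | yes _ = refl
    ... | no u≢u = contradiction refl u≢u

    μw≡u : μ w ≡ u
    μw≡u with w ≟ u
    ... | yes w≡u = contradiction (sym w≡u) (Adj⇒≢ uw)
    ... | no _ = refl

    matched : ∀ v → ((_≡ u) ∪ (_≡ w)) v → ((_≡ u) ∪ (_≡ w)) (μ v) × Adj G v (μ v) × μ (μ v) ≡ v
    matched v (inj₁ refl) = inj₂ μu≡w , subst (Adj G u) (sym μu≡w) uw , trans (cong μ μu≡w) μw≡u
    matched v (inj₂ refl) = inj₁ μw≡u , subst (Adj G w) (sym μw≡u) (Adj-sym uw) , trans (cong μ μw≡u) μu≡w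

  pairedCoalition-singletons : ∀ {i j} → j ≢ i → PairedDominating G ((_≡ i) ∪ (_≡ j))
    → PairedCoalition G (_≡ i) (_≡ j)
  pairedCoalition-singletons j≢i pd =
      (λ v v≡i v≡j → j≢i (trans (sym v≡j) v≡i))
    , ¬HasPerfectMatching-singleton ∘ proj₂
    , ¬HasPerfectMatching-singleton ∘ proj₂
    , pd

  HasPerfectMatching-pendant : ∀ {x y} {S : VSet n} → deg G x ≡ 1 → Adj G x y
    → HasPerfectMatching G S → S x → S y
  HasPerfectMatching-pendant dx xy (μ , matched) Sx with matched _ Sx
  ... | Sμx , xμx , _ = subst _ (deg≡1⇒Adj-unique dx xμx xy) Sμx

  Dominating-pendant-pair⇒Universal : ∀ {x y} {S : VSet n} → deg G x ≡ 1 → Adj G x y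
    → Dominating G S → (∀ {v} → S v → v ≡ x ⊎ v ≡ y) → Universal y
  Dominating-pendant-pair⇒Universal dx xy dom S⊆xy z z≢y with dom z
  ... | inj₁ Sz with S⊆xy Sz
  ...   | inj₁ refl = Adj-sym xy
  ...   | inj₂ z≡y = contradiction z≡y z≢y
  Dominating-pendant-pair⇒Universal dx xy dom S⊆xy z z≢y | inj₂ (u , Su , zu) with S⊆xy Su
  ...   | inj₁ refl = contradiction (deg≡1⇒Adj-unique dx (Adj-sym zu) xy) z≢y
  ...   | inj₂ refl = Adj-sym zu

  pcPartition⇒≤ : ∀ {k} → PCPartition G k → k ≤ n
  pcPartition⇒≤ (_ , surj , _) = strictlySurjective⇒≤ surj

  pcPartition-n⇒Universal : ∀ {x y} → PCPartition G n → deg G x ≡ 1 → Adj G x y → Universal y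
  pcPartition-n⇒Universal {x} {y} (f , surj , _ , coalition) dx xy
    with coalition (f x)
  ... | j , _ , _ , _ , _ , dom , matching =
    Dominating-pendant-pair⇒Universal dx xy dom ⊆xy
    where
    f-injective : Injective _≡_ _≡_ f
    f-injective = strictlySurjective⇒injective surj

    Sy : Class f (f x) y ⊎ Class f j y
    Sy = HasPerfectMatching-pendant dx xy matching (inj₁ refl)

    ⊆xy : ∀ {v} → (Class f (f x) ∪ Class f j) v → v ≡ x ⊎ v ≡ y
    ⊆xy (inj₁ fv≡fx) = inj₁ (f-injective fv≡fx)
    ⊆xy (inj₂ fv≡j) with Sy
    ... | inj₁ fy≡fx = contradiction (f-injective fy≡fx) (Adj⇒≢ xy ∘ sym)
    ... | inj₂ fy≡j = inj₂ (f-injective (trans fv≡j (sym fy≡j)))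

  Universal⇒pcPartition-singletons : ∀ {x y} → Adj G x y → Universal y → PCPartition G n
  Universal⇒pcPartition-singletons {x} {y} xy U =
    (λ v → v) , (λ i → i , refl) , (λ i → ¬HasPerfectMatching-singleton ∘ proj₂) , coalition
    where
    coalition : ∀ i → Σ (Fin n) λ j → j ≢ i × PairedCoalition G (_≡ i) (_≡ j)
    coalition i with i ≟ y
    ... | no i≢y = y , i≢y ∘ sym , pairedCoalition-singletons (i≢y ∘ sym)
        (Dominating-mono inj₂ (Universal⇒Dominating U) , HasPerfectMatching-edge (Adj-sym (U i i≢y)))
    ... | yes refl = x , Adj⇒≢ xy , pairedCoalition-singletons (Adj⇒≢ xy)
        (Dominating-mono inj₁ (Universal⇒Dominating U) , HasPerfectMatching-edge (Adj-sym xy))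

mainTheorem12 : (n : ℕ) → 2 ≤ n → (G : Graph n) → MinDegreeIs G 1
    → (x y : Fin n) → deg G x ≡ 1 → Adj G x y
    → (PCNumberIs G n ⇔ (∀ z → z ≢ y → Adj G y z))
mainTheorem12 n 2≤n G _ x y dx xy = mk⇔ forward backward
  where
  forward : PCNumberIs G n → Universal G y
  forward (inj₁ (P , _)) = pcPartition-n⇒Universal G P dx xy
  forward (inj₂ (refl , _)) = contradiction 2≤n λ ()

  backward : Universal G y → PCNumberIs G n
  backward U = inj₁ (Universal⇒pcPartition-singletons G xy U , λ _ → pcPartition⇒≤ G)
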